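{- Let $p,q$ be positive integers. The complete bipartite graph $K_{p,q}$ is P2-win if at least one of $p,q$ is even. If $p = 3$ and $q \ge 5$ is odd, then $K_{p,q}$ is P1-win.
   Context: Trail Trap on a finite simple undirected graph $G$: Player 1 (P1) chooses a vertex, places a token on it and moves it along an incident edge $e$ to the other endpoint. Player 2 (P2) then places their own token on any vertex and moves it along an incident edge $f \neq e$. Thereafter the players alternate, starting with P1, each moving their own token from its current vertex along an unused edge (an edge not previously traversed, in either direction, by either player) to the adjacent vertex; vertices may be revisited and the two tokens may share a vertex. The first player unable to move loses. $G$ is P1-win if P1 has a winning strategy, and P2-win otherwise. -}

module Defs where

open import Data.Nat using (ℕ)
open import Data.Fin using (Fin)
open import Data.Empty using (⊥)
open import Data.Unit using (⊤)
open import Data.Sum using (_⊎_; inj₁; inj₂)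
open import Data.Product using (_×_; _,_; Σ; ∃)
open import Data.List using (List; []; _∷_)
open import Data.List.Membership.Propositional using (_∈_)
open import Relation.Binary.PropositionalEquality using (_≡_)
open import Relation.Nullary using (¬_)

record SimpleGraph : Set₁ where
  field
    n     : ℕ
    Adj   : Fin n → Fin n → Set
    sym   : ∀ {u v} → Adj u v → Adj v u
    irrefl : ∀ {v} → ¬ Adj v v

module TrailTrap (G : SimpleGraph) where
  open SimpleGraph G

  V : Set
  V = Fin n

  Used : List (V × V) → V → V → Set
  Used used a b = ((a , b) ∈ used) ⊎ ((b , a) ∈ used)

  -- A position with the player to move at vertex a, the other player at b,
  -- and the list of used edges.
  data Win  (used : List (V × V)) (a b : V) : Set
  data Lose (used : List (V × V)) (a b : V) : Set

  data Win used a b where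
    move : (w : V) → Adj a w → ¬ Used used a w →
           Lose ((a , w) ∷ used) b w → Win used a b

  data Lose used a b where
    stuck-or-all : ((w : V) → Adj a w → ¬ Used used a w →
                    Win ((a , w) ∷ used) b w) → Lose used a b

  SameEdge : V → V → V → V → Set
  SameEdge u x v w = ((u ≡ v) × (x ≡ w)) ⊎ ((u ≡ w) × (x ≡ v))

  -- P1 chooses v and edge e = {v,w}; for every reply of P2 (any vertex u, edge
  -- f = {u,x} ≠ e), P1, now to move from w with P2 at x, has a winning strategy.
  P1-win : Set
  P1-win = Σ V λ v → Σ V λ w → Adj v w ×
           ((u x : V) → Adj u x → ¬ SameEdge u x v w →
            Win ((u , x) ∷ (v , w) ∷ []) w x)

  P2-win : Set
  P2-win = ¬ P1-win

open TrailTrap public using (P1-win; P2-win)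

open import Data.Nat using (_+_; _<_; _≤_)
open import Data.Fin using (toℕ)
open import Data.Nat.Properties using (<-irrefl; ≤-trans)
import Data.Nat.Properties as NP

KAdj : (p q : ℕ) → Fin (p + q) → Fin (p + q) → Set
KAdj p q i j = ((toℕ i < p) × (p ≤ toℕ j)) ⊎ ((p ≤ toℕ i) × (toℕ j < p))

K : (p q : ℕ) → SimpleGraph
K p q = record
  { n = p + q
  ; Adj = KAdj p q
  ; sym = λ { (inj₁ (a , b)) → inj₂ (b , a) ; (inj₂ (a , b)) → inj₁ (b , a) }
  ; irrefl = λ { (inj₁ (a , b)) → NP.<⇒≱ a b ; (inj₂ (a , b)) → NP.<⇒≱ b a }
  }

-- If one side of K_{p,q} is even, pair up its vertices: swapping the pairs is an
-- involutive automorphism σ fixing no edge, and P2 answers every move along e by the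
-- move along σ e.  The set of used edges stays σ-invariant, so P2 is never stuck.
--
-- For K_{3,q}, describe a vertex of the q-side by the set of its unused edges.  The
-- game is simulated by an abstract game that only counts the vacant vertices of each
-- kind.  With both tokens on the 3-side, no vacant vertex having exactly two unused
-- edges, and an odd number of fresh (untouched) vertices, the player to move wins:
-- they enter a fresh vertex; the only reply that does not lose at once is to enter
-- another fresh vertex, after which both leave again, turning the two vertices into
-- dead ends (one unused edge) and restoring the situation with two fewer fresh
-- vertices.  With an even number the player to move loses, as long as the dead ends
-- let the opponent answer the final round.  P1 opens at a 3-side vertex, and every
-- reply of P2 leads to such an even position for P2; for q = 5 one opening is settled
-- by a finite search.

module Submission where

open import Defs
open import Data.Nat using (ℕ; zero; suc; pred; _+_; _*_; _≤_; _<_; z≤n; s≤s)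
open import Data.Nat.Properties
  using (m≤m+n; <⇒≱; n≤1+n; ≤-refl; ≤-trans; +-comm; +-assoc; +-identityʳ; +-suc; pred-mono-≤; 0≢1+n)
open import Data.Nat.Divisibility using (_∣_; divides; ∣m∣n⇒∣m+n; ∣-refl)
open import Data.Fin using (Fin; zero; suc; toℕ; _↑ˡ_; _↑ʳ_; splitAt; join)
open import Data.Fin.Patterns using (0F; 1F; 2F)
open import Data.Fin.Properties
  using (_≟_; suc-injective; toℕ<n; toℕ-↑ˡ; toℕ-↑ʳ; ↑ˡ-injective; ↑ʳ-injective; splitAt-↑ˡ; splitAt-↑ʳ; join-splitAt)
open import Data.Bool using (Bool; true; false; not; _∧_; if_then_else_)
open import Data.Bool.Properties using (∧-identityʳ; ∧-zeroʳ) renaming (_≟_ to _≟ᵇ_)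
open import Data.Sum using (_⊎_; inj₁; inj₂)
import Data.Sum as Sum
open import Data.Product using (_×_; _,_; proj₁; proj₂; ∃; ∃₂)
open import Data.Product.Properties using (≡-dec)
open import Data.List using (List; []; _∷_)
open import Data.List.Relation.Unary.Any using (here; there)
open import Data.Maybe using (Maybe; just; nothing; map; _<∣>_; from-just)
open import Data.Empty using (⊥-elim)
open import Function using (id; _∘_; _$_)
open import Relation.Nullary using (¬_; Dec; yes; no; does; map′; _×-dec_; _⊎-dec_)
open import Relation.Nullary.Decidable using (dec-true; dec-false)
open import Relation.Binary.Definitions using (DecidableEquality)
open import Relation.Binary.PropositionalEquality
  using (_≡_; _≢_; refl; sym; trans; cong; cong₂; cong-app; subst; subst₂; ≢-sym; module ≡-Reasoning)

-- One side even: mirror strategies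

module Mirror (G : SimpleGraph) where
  open SimpleGraph G
  open TrailTrap G hiding (P1-win; P2-win)

  record EdgeFreeInvolution : Set where
    field
      σ           : V → V
      involutive  : ∀ v → σ (σ v) ≡ v
      preservesAdj : ∀ {u v} → Adj u v → Adj (σ u) (σ v)
      movesEdges  : ∀ {u v} → Adj u v → ¬ SameEdge (σ u) (σ v) u v

  Used-there : ∀ {U e c d} → Used U c d → Used (e ∷ U) c d
  Used-there (inj₁ c∈U) = inj₁ (there c∈U)
  Used-there (inj₂ c∈U) = inj₂ (there c∈U)

  Used-head : ∀ {U a b c d} → SameEdge c d a b → Used ((a , b) ∷ U) c d
  Used-head (inj₁ (refl , refl)) = inj₁ (here refl)
  Used-head (inj₂ (refl , refl)) = inj₂ (here refl)

  Used-∷⁻ : ∀ {U a b c d} → Used ((a , b) ∷ U) c d → SameEdge c d a b ⊎ Used U c d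
  Used-∷⁻ (inj₁ (here refl))  = inj₁ (inj₁ (refl , refl))
  Used-∷⁻ (inj₂ (here refl))  = inj₁ (inj₂ (refl , refl))
  Used-∷⁻ (inj₁ (there c∈U)) = inj₂ (inj₁ c∈U)
  Used-∷⁻ (inj₂ (there c∈U)) = inj₂ (inj₂ c∈U)

  Used-flip : ∀ {U x y} → Used U x y → Used U y x
  Used-flip (inj₁ xy∈U) = inj₂ xy∈U
  Used-flip (inj₂ yx∈U) = inj₁ yx∈U

  module _ (ι : EdgeFreeInvolution) where
    open EdgeFreeInvolution ι

    SameEdge-σ : ∀ {a b c d} → SameEdge c d (σ a) (σ b) → SameEdge (σ c) (σ d) a b
    SameEdge-σ (inj₁ (refl , refl)) = inj₁ (involutive _ , involutive _)
    SameEdge-σ (inj₂ (refl , refl)) = inj₂ (involutive _ , involutive _)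

    SameEdge-map : ∀ {a b c d} → SameEdge c d a b → SameEdge (σ c) (σ d) (σ a) (σ b)
    SameEdge-map (inj₁ (refl , refl)) = inj₁ (refl , refl)
    SameEdge-map (inj₂ (refl , refl)) = inj₂ (refl , refl)

    Symmetric : List (V × V) → Set
    Symmetric U = ∀ {c d} → Used U c d → Used U (σ c) (σ d)

    Symmetric-[] : Symmetric []
    Symmetric-[] (inj₁ ())
    Symmetric-[] (inj₂ ())

    Symmetric-∷ : ∀ {U a b} → Symmetric U → Symmetric ((σ a , σ b) ∷ (a , b) ∷ U)
    Symmetric-∷ sym-U used with Used-∷⁻ used
    ... | inj₁ mirrored = Used-there (Used-head (SameEdge-σ mirrored))
    ... | inj₂ used′ with Used-∷⁻ used′
    ...   | inj₁ same = Used-head (SameEdge-map same)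
    ...   | inj₂ old  = Used-there (Used-there (sym-U old))

    mirror-unused : ∀ {U a b} → Symmetric U → Adj a b → ¬ Used U a b →
                    ¬ Used ((a , b) ∷ U) (σ a) (σ b)
    mirror-unused sym-U ab unused used with Used-∷⁻ used
    ... | inj₁ same = movesEdges ab same
    ... | inj₂ old  = unused (subst₂ (Used _) (involutive _) (involutive _) (sym-U old))

    mirror-never-wins : ∀ {U a} → Symmetric U → ¬ Win U a (σ a)
    mirror-never-wins sym-U (move z az unused (stuck-or-all reply)) =
      mirror-never-wins (Symmetric-∷ sym-U)
        (reply (σ z) (preservesAdj az) (mirror-unused sym-U az unused))

    mirror⇒P2-win : P2-win G
    mirror⇒P2-win (v , w , vw , reply) =
      mirror-never-wins (Symmetric-∷ Symmetric-[])
        (reply (σ v) (σ w) (preservesAdj vw) (movesEdges vw))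

pairSwap : ∀ k → Fin (k * 2) → Fin (k * 2)
pairSwap (suc k) zero          = suc zero
pairSwap (suc k) (suc zero)    = zero
pairSwap (suc k) (suc (suc i)) = suc (suc (pairSwap k i))

pairSwap-involutive : ∀ k i → pairSwap k (pairSwap k i) ≡ i
pairSwap-involutive (suc k) zero          = refl
pairSwap-involutive (suc k) (suc zero)    = refl
pairSwap-involutive (suc k) (suc (suc i)) = cong (λ j → suc (suc j)) (pairSwap-involutive k i)

pairSwap-≢ : ∀ k i → pairSwap k i ≢ i
pairSwap-≢ (suc k) zero          ()
pairSwap-≢ (suc k) (suc zero)    ()
pairSwap-≢ (suc k) (suc (suc i)) eq = pairSwap-≢ k i (suc-injective (suc-injective eq))

module Bipartite (p q : ℕ) where
  open SimpleGraph (K p q) using (Adj)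
  open TrailTrap (K p q) using (SameEdge)

  data Side : Fin (p + q) → Set where
    left  : (i : Fin p) → Side (i ↑ˡ q)
    right : (j : Fin q) → Side (p ↑ʳ j)

  side : ∀ u → Side u
  side u with splitAt p u | join-splitAt p q u
  ... | inj₁ i | refl = left i
  ... | inj₂ j | refl = right j

  left-< : ∀ i → toℕ (i ↑ˡ q) < p
  left-< i = subst (_< p) (sym (toℕ-↑ˡ i q)) (toℕ<n i)

  right-≥ : (j : Fin q) → p ≤ toℕ (p ↑ʳ j)
  right-≥ j = subst (p ≤_) (sym (toℕ-↑ʳ p j)) (m≤m+n p (toℕ j))

  left≢right : (i : Fin p) (j : Fin q) → i ↑ˡ q ≢ p ↑ʳ j
  left≢right i j eq = <⇒≱ (left-< i) (subst (λ u → p ≤ toℕ u) (sym eq) (right-≥ j))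

  left-right-adj : (i : Fin p) (j : Fin q) → Adj (i ↑ˡ q) (p ↑ʳ j)
  left-right-adj i j = inj₁ (left-< i , right-≥ j)

  right-left-adj : (i : Fin p) (j : Fin q) → Adj (p ↑ʳ j) (i ↑ˡ q)
  right-left-adj i j = inj₂ (right-≥ j , left-< i)

  left-left-¬adj : ∀ i i′ → ¬ Adj (i ↑ˡ q) (i′ ↑ˡ q)
  left-left-¬adj i i′ (inj₁ (_ , ≥p)) = <⇒≱ (left-< i′) ≥p
  left-left-¬adj i i′ (inj₂ (≥p , _)) = <⇒≱ (left-< i) ≥p

  right-right-¬adj : (j j′ : Fin q) → ¬ Adj (p ↑ʳ j) (p ↑ʳ j′)
  right-right-¬adj j j′ (inj₁ (<p , _)) = <⇒≱ <p (right-≥ j)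
  right-right-¬adj j j′ (inj₂ (_ , <p)) = <⇒≱ <p (right-≥ j′)

  module _ (σA : Fin p → Fin p) (σB : Fin q → Fin q) where

    sideMap : Fin (p + q) → Fin (p + q)
    sideMap u = join p q (Sum.map σA σB (splitAt p u))

    sideMap-left : ∀ i → sideMap (i ↑ˡ q) ≡ σA i ↑ˡ q
    sideMap-left i rewrite splitAt-↑ˡ p i q = refl

    sideMap-right : ∀ j → sideMap (p ↑ʳ j) ≡ p ↑ʳ σB j
    sideMap-right j rewrite splitAt-↑ʳ p q j = refl

    sideMap-edge-involution :
      (∀ i → σA (σA i) ≡ i) → (∀ j → σB (σB j) ≡ j) →
      (∀ i j → ¬ (σA i ≡ i × σB j ≡ j)) →
      Mirror.EdgeFreeInvolution (K p q)
    sideMap-edge-involution σA-inv σB-inv noFixedEdge = record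
      { σ = sideMap ; involutive = involutive ; preservesAdj = preservesAdj ; movesEdges = movesEdges }
      where
      involutive : ∀ u → sideMap (sideMap u) ≡ u
      involutive u with side u
      ... | left i  = trans (cong sideMap (sideMap-left i))
                            (trans (sideMap-left (σA i)) (cong (_↑ˡ q) (σA-inv i)))
      ... | right j = trans (cong sideMap (sideMap-right j))
                            (trans (sideMap-right (σB j)) (cong (p ↑ʳ_) (σB-inv j)))

      preservesAdj : ∀ {u v} → Adj u v → Adj (sideMap u) (sideMap v)
      preservesAdj {u} {v} uv with side u | side v
      ... | left i  | left i′  = ⊥-elim (left-left-¬adj i i′ uv)
      ... | right j | right j′ = ⊥-elim (right-right-¬adj j j′ uv)
      ... | left i  | right j
        rewrite sideMap-left i | sideMap-right j = left-right-adj (σA i) (σB j)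
      ... | right j | left i
        rewrite sideMap-left i | sideMap-right j = right-left-adj (σA i) (σB j)

      left-right-moved : ∀ i j → ¬ SameEdge (σA i ↑ˡ q) (p ↑ʳ σB j) (i ↑ˡ q) (p ↑ʳ j)
      left-right-moved i j (inj₁ (eqA , eqB)) = noFixedEdge i j (↑ˡ-injective q _ _ eqA , ↑ʳ-injective p _ _ eqB)
      left-right-moved i j (inj₂ (eq , _))    = left≢right (σA i) j eq

      right-left-moved : ∀ i j → ¬ SameEdge (p ↑ʳ σB j) (σA i ↑ˡ q) (p ↑ʳ j) (i ↑ˡ q)
      right-left-moved i j (inj₁ (eqB , eqA)) = noFixedEdge i j (↑ˡ-injective q _ _ eqA , ↑ʳ-injective p _ _ eqB)
      right-left-moved i j (inj₂ (eq , _))    = left≢right i (σB j) (sym eq)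

      movesEdges : ∀ {u v} → Adj u v → ¬ SameEdge (sideMap u) (sideMap v) u v
      movesEdges {u} {v} uv same with side u | side v
      ... | left i  | left i′  = left-left-¬adj i i′ uv
      ... | right j | right j′ = right-right-¬adj j j′ uv
      ... | left i  | right j  =
        left-right-moved i j (subst₂ (λ x y → SameEdge x y _ _) (sideMap-left i) (sideMap-right j) same)
      ... | right j | left i   =
        right-left-moved i j (subst₂ (λ x y → SameEdge x y _ _) (sideMap-right j) (sideMap-left i) same)

even-side⇒P2-win : ∀ p q → (2 ∣ p) ⊎ (2 ∣ q) → P2-win (K p q)
even-side⇒P2-win p q (inj₁ (divides k refl)) =
  Mirror.mirror⇒P2-win (K p q)
    (Bipartite.sideMap-edge-involution p q (pairSwap k) id
      (pairSwap-involutive k) (λ _ → refl) (λ i _ (fixed , _) → pairSwap-≢ k i fixed))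
even-side⇒P2-win p q (inj₂ (divides k refl)) =
  Mirror.mirror⇒P2-win (K p q)
    (Bipartite.sideMap-edge-involution p q id (pairSwap k)
      (λ _ → refl) (pairSwap-involutive k) (λ _ j (_ , fixed) → pairSwap-≢ k j fixed))

-- An abstract position of the game on K_{3,q}: a vertex of the q-side is described by the
-- Mask of its unused edges to the three vertices of the 3-side, the vacant ones (carrying
-- no token) are only counted per mask, and the position of the two tokens is recorded
-- with the player to move first.
record Mask : Set where
  constructor ⟨_,_,_⟩
  field to₀ to₁ to₂ : Bool

has : Mask → Fin 3 → Bool
has ⟨ x , _ , _ ⟩ 0F = x
has ⟨ _ , y , _ ⟩ 1F = y
has ⟨ _ , _ , z ⟩ 2F = z

delete : Mask → Fin 3 → Mask
delete ⟨ x , y , z ⟩ 0F = ⟨ false , y , z ⟩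
delete ⟨ x , y , z ⟩ 1F = ⟨ x , false , z ⟩
delete ⟨ x , y , z ⟩ 2F = ⟨ x , y , false ⟩

_≟ᴹ_ : DecidableEquality Mask
⟨ x , y , z ⟩ ≟ᴹ ⟨ x′ , y′ , z′ ⟩ =
  map′ (λ { (refl , refl , refl) → refl }) (λ { refl → refl , refl , refl })
       (x ≟ᵇ x′ ×-dec y ≟ᵇ y′ ×-dec z ≟ᵇ z′)

_==ᴹ_ : Mask → Mask → Bool
m ==ᴹ m′ = does (m ≟ᴹ m′)

==ᴹ⇒≡ : ∀ {m m′} → m ==ᴹ m′ ≡ true → m ≡ m′
==ᴹ⇒≡ {m} {m′} = witness (m ≟ᴹ m′)
  where
  witness : ∀ {P : Set} (P? : Dec P) → does P? ≡ true → P
  witness (yes p) _ = p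

Count : Set
Count = Mask → ℕ

occupy release : Mask → Count → Count
occupy  m c m′ = if m ==ᴹ m′ then pred (c m′) else c m′
release m c m′ = if m ==ᴹ m′ then suc (c m′) else c m′

data Position : Set where
  AA     : Fin 3 → Fin 3 → Position
  AB     : Fin 3 → Mask → Position
  BA     : Mask → Fin 3 → Position
  BB     : Mask → Mask → Position
  shared : Mask → Position

record State : Set where
  constructor st
  field
    counts   : Count
    position : Position

data Step : State → State → Set where
  enterᴬᴬ : ∀ {c a b} m → has m a ≡ true → ∀ n → c m ≡ suc n →
            Step (st c (AA a b)) (st (occupy m c) (AB b (delete m a)))
  enterᴬᴮ : ∀ {c a m′} m → has m a ≡ true → ∀ n → c m ≡ suc n →
            Step (st c (AB a m′)) (st (occupy m c) (BB m′ (delete m a)))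
  joinᴬᴮ  : ∀ {c a m′} → has m′ a ≡ true → Step (st c (AB a m′)) (st c (shared (delete m′ a)))
  leaveᴮᴬ : ∀ {c m b} a → has m a ≡ true → Step (st c (BA m b)) (st (release (delete m a) c) (AA b a))
  leaveᴮᴮ : ∀ {c m m′} a → has m a ≡ true → Step (st c (BB m m′)) (st (release (delete m a) c) (BA m′ a))
  leaveShared : ∀ {c m} a → has m a ≡ true → Step (st c (shared m)) (st c (BA (delete m a) a))

data Wins (s : State) : Set
data Loses (s : State) : Set

data Wins s where
  play : ∀ s′ → Step s s′ → Loses s′ → Wins s

data Loses s where
  every : (∀ s′ → Step s s′ → Wins s′) → Loses s

loses-reply : ∀ {s s′} → Loses s → Step s s′ → Wins s′
loses-reply (every wins) = wins _

mask-ext : ∀ {m m′} → (∀ a → has m a ≡ has m′ a) → m ≡ m′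
mask-ext {⟨ _ , _ , _ ⟩} {⟨ _ , _ , _ ⟩} agree
  with agree 0F | agree 1F | agree 2F
... | refl | refl | refl = refl

has-delete-same : ∀ m a → has (delete m a) a ≡ false
has-delete-same ⟨ _ , _ , _ ⟩ 0F = refl
has-delete-same ⟨ _ , _ , _ ⟩ 1F = refl
has-delete-same ⟨ _ , _ , _ ⟩ 2F = refl

has-delete-other : ∀ m {a a′} → a′ ≢ a → has (delete m a) a′ ≡ has m a′
has-delete-other ⟨ _ , _ , _ ⟩ {0F} {0F} a′≢a = ⊥-elim (a′≢a refl)
has-delete-other ⟨ _ , _ , _ ⟩ {0F} {1F} _    = refl
has-delete-other ⟨ _ , _ , _ ⟩ {0F} {2F} _    = refl
has-delete-other ⟨ _ , _ , _ ⟩ {1F} {0F} _    = refl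
has-delete-other ⟨ _ , _ , _ ⟩ {1F} {1F} a′≢a = ⊥-elim (a′≢a refl)
has-delete-other ⟨ _ , _ , _ ⟩ {1F} {2F} _    = refl
has-delete-other ⟨ _ , _ , _ ⟩ {2F} {0F} _    = refl
has-delete-other ⟨ _ , _ , _ ⟩ {2F} {1F} _    = refl
has-delete-other ⟨ _ , _ , _ ⟩ {2F} {2F} a′≢a = ⊥-elim (a′≢a refl)

release-same : ∀ m c → release m c m ≡ suc (c m)
release-same m c = cong (if_then suc (c m) else c m) (dec-true (m ≟ᴹ m) refl)

release-other : ∀ {m m′} c → m ≢ m′ → release m c m′ ≡ c m′
release-other {m} {m′} c m≢m′ = cong (if_then suc (c m′) else c m′) (dec-false (m ≟ᴹ m′) m≢m′)

occupy-same : ∀ m c → occupy m c m ≡ pred (c m)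
occupy-same m c = cong (if_then pred (c m) else c m) (dec-true (m ≟ᴹ m) refl)

occupy-other : ∀ {m m′} c → m ≢ m′ → occupy m c m′ ≡ c m′
occupy-other {m} {m′} c m≢m′ = cong (if_then pred (c m′) else c m′) (dec-false (m ≟ᴹ m′) m≢m′)

release-≥ : ∀ m {m′} c → c m′ ≤ release m c m′
release-≥ m {m′} c with m ≟ᴹ m′
... | yes refl = subst (c m ≤_) (sym (release-same m c)) (n≤1+n (c m))
... | no m≢m′  = subst (c m′ ≤_) (sym (release-other c m≢m′)) ≤-refl

-- Simulation of K_{3,q} by the abstract game

indicator : Bool → ℕ
indicator true  = 1
indicator false = 0

drop-indicator : ∀ {x y} b → x + indicator b ≡ y → x ≡ (if b then pred y else y)
drop-indicator {x} true  eq = trans (sym (cong pred (+-comm x 1))) (cong pred eq)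
drop-indicator {x} false eq = trans (sym (+-identityʳ x)) eq

add-indicator : ∀ {x y} b → x ≡ y + indicator b → x ≡ (if b then suc y else y)
add-indicator {y = y} true  eq = trans eq (+-comm y 1)
add-indicator {y = y} false eq = trans eq (+-identityʳ y)

∧-true⁻ : ∀ {x y} → x ∧ y ≡ true → x ≡ true × y ≡ true
∧-true⁻ {true} {true} _ = refl , refl

count : ∀ {n} → (Fin n → Bool) → ℕ
count {zero}  P = 0
count {suc n} P = indicator (P zero) + count (P ∘ suc)

count-cong : ∀ {n} {P P′ : Fin n → Bool} → (∀ j → P j ≡ P′ j) → count P ≡ count P′
count-cong {zero}  agree = refl
count-cong {suc n} agree = cong₂ _+_ (cong indicator (agree zero)) (count-cong (agree ∘ suc))

count-change : ∀ {n} (P P′ : Fin n → Bool) j₀ → (∀ j → j ≢ j₀ → P j ≡ P′ j) →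
               count P′ + indicator (P j₀) ≡ count P + indicator (P′ j₀)
count-change {suc n} P P′ zero agree
  rewrite count-cong {P = P ∘ suc} {P′ ∘ suc} (λ j → agree (suc j) λ ())
  = outer-swap (indicator (P′ zero)) _ (indicator (P zero))
  where
  outer-swap : ∀ x r y → x + r + y ≡ y + r + x
  outer-swap x r y = trans (+-comm (x + r) y) (trans (cong (y +_) (+-comm x r)) (sym (+-assoc y r x)))
count-change {suc n} P P′ (suc j₀) agree
  rewrite agree zero (λ ())
        | +-assoc (indicator (P′ zero)) (count (P′ ∘ suc)) (indicator (P (suc j₀)))
        | +-assoc (indicator (P′ zero)) (count (P ∘ suc)) (indicator (P′ (suc j₀)))
  = cong (indicator (P′ zero) +_)
         (count-change (P ∘ suc) (P′ ∘ suc) j₀ (λ j j≢j₀ → agree (suc j) (j≢j₀ ∘ suc-injective)))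

count-const : ∀ {n} b → count {n} (λ _ → b) ≡ (if b then n else 0)
count-const {zero}  true  = refl
count-const {zero}  false = refl
count-const {suc n} true  = cong (1 +_) (count-const {n} true)
count-const {suc n} false = count-const {n} false

count-positive : ∀ {n} (P : Fin n → Bool) j → P j ≡ true → ∃ λ k → count P ≡ suc k
count-positive P zero Pj rewrite Pj = _ , refl
count-positive {suc n} P (suc j) Pj with count-positive (P ∘ suc) j Pj
... | k , eq = indicator (P zero) + k , trans (cong (indicator (P zero) +_) eq) (+-suc _ k)

count-witness : ∀ {n} (P : Fin n → Bool) {k} → count P ≡ suc k → ∃ λ j → P j ≡ true
count-witness {suc n} P eq with P zero in P0
... | true  = zero , P0
... | false with count-witness (P ∘ suc) eq
...   | j , Pj = suc j , Pj

module Abstraction (q : ℕ) where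
  open SimpleGraph (K 3 q) using (Adj)
  open TrailTrap (K 3 q) hiding (P1-win; P2-win)
  open Bipartite 3 q
  open Mirror (K 3 q) using (Used-there; Used-head; Used-∷⁻; Used-flip)
  open import Data.List.Membership.DecPropositional (≡-dec (_≟_ {3 + q}) (_≟_ {3 + q})) using (_∈?_)
  open ≡-Reasoning

  A : Fin 3 → V
  A a = a ↑ˡ q

  B : Fin q → V
  B j = 3 ↑ʳ j

  used? : ∀ U x y → Dec (Used U x y)
  used? U x y = ((x , y) ∈? U) ⊎-dec ((y , x) ∈? U)

  free : List (V × V) → Fin 3 → Fin q → Bool
  free U a j = not (does (used? U (A a) (B j)))

  mask : List (V × V) → Fin q → Mask
  mask U j = ⟨ free U 0F j , free U 1F j , free U 2F j ⟩

  has-mask : ∀ U j a → has (mask U j) a ≡ free U a j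
  has-mask U j 0F = refl
  has-mask U j 1F = refl
  has-mask U j 2F = refl

  free⇒unused : ∀ {U a j} → free U a j ≡ true → ¬ Used U (A a) (B j)
  free⇒unused {U} {a} {j} fr used
    with () ← trans (sym fr) (cong not (dec-true (used? U (A a) (B j)) used))

  unused⇒free : ∀ {U a j} → ¬ Used U (A a) (B j) → free U a j ≡ true
  unused⇒free {U} {a} {j} unused = cong not (dec-false (used? U (A a) (B j)) unused)

  IsEdgeAt : Fin 3 → Fin q → V × V → Set
  IsEdgeAt a j e = e ≡ (A a , B j) ⊎ e ≡ (B j , A a)

  used-inserted : ∀ {U a j e} → IsEdgeAt a j e → Used (e ∷ U) (A a) (B j)
  used-inserted (inj₁ refl) = Used-head (inj₁ (refl , refl))
  used-inserted (inj₂ refl) = Used-head (inj₂ (refl , refl))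

  used-elsewhere : ∀ {U a a′ j₀ j e} → IsEdgeAt a j₀ e → ¬ (a′ ≡ a × j ≡ j₀) →
                   Used (e ∷ U) (A a′) (B j) → Used U (A a′) (B j)
  used-elsewhere {a′ = a′} {j₀} (inj₁ refl) other used with Used-∷⁻ used
  ... | inj₁ (inj₁ (eqA , eqB)) = ⊥-elim (other (↑ˡ-injective q _ _ eqA , ↑ʳ-injective 3 _ _ eqB))
  ... | inj₁ (inj₂ (eq , _))    = ⊥-elim (left≢right a′ j₀ eq)
  ... | inj₂ old                = old
  used-elsewhere {a′ = a′} {j₀} (inj₂ refl) other used with Used-∷⁻ used
  ... | inj₁ (inj₁ (eq , _))    = ⊥-elim (left≢right a′ j₀ eq)
  ... | inj₁ (inj₂ (eqA , eqB)) = ⊥-elim (other (↑ˡ-injective q _ _ eqA , ↑ʳ-injective 3 _ _ eqB))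
  ... | inj₂ old                = old

  free-inserted : ∀ {U a j e} → IsEdgeAt a j e → free (e ∷ U) a j ≡ false
  free-inserted {U} {a} {j} {e} at = cong not (dec-true (used? (e ∷ U) (A a) (B j)) (used-inserted at))

  free-elsewhere : ∀ {U a a′ j₀ j e} → IsEdgeAt a j₀ e → ¬ (a′ ≡ a × j ≡ j₀) →
                   free (e ∷ U) a′ j ≡ free U a′ j
  free-elsewhere {U} {a′ = a′} {j = j} {e} at other with used? U (A a′) (B j) in eq
  ... | yes used = trans (cong not (dec-true (used? (e ∷ U) _ _) (Used-there used)))
                         (sym (cong (not ∘ does) eq))
  ... | no unused = trans (cong not (dec-false (used? (e ∷ U) _ _) (unused ∘ used-elsewhere at other)))
                          (sym (cong (not ∘ does) eq))

  mask-inserted : ∀ {U a j e} → IsEdgeAt a j e → mask (e ∷ U) j ≡ delete (mask U j) a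
  mask-inserted {U} {a} {j} {e} at = mask-ext componentwise
    where
    componentwise : ∀ a′ → has (mask (e ∷ U) j) a′ ≡ has (delete (mask U j) a) a′
    componentwise a′ with a′ ≟ a
    ... | yes refl = trans (has-mask (e ∷ U) j a) (trans (free-inserted {U} at) (sym (has-delete-same (mask U j) a)))
    ... | no a′≢a  = trans (has-mask (e ∷ U) j a′)
                       (trans (free-elsewhere {U} at (a′≢a ∘ proj₁))
                         (trans (sym (has-mask U j a′)) (sym (has-delete-other (mask U j) a′≢a))))

  mask-elsewhere : ∀ {U a j₀ j e} → IsEdgeAt a j₀ e → j ≢ j₀ → mask (e ∷ U) j ≡ mask U j
  mask-elsewhere {U} {j = j} {e} at j≢j₀ = mask-ext λ a′ →
    trans (has-mask (e ∷ U) j a′) (trans (free-elsewhere {U} at (j≢j₀ ∘ proj₂)) (sym (has-mask U j a′)))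

  notAt : V → Fin q → Bool
  notAt v j = not (does (v ≟ B j))

  vacant : V → V → Fin q → Bool
  vacant v w j = notAt v j ∧ notAt w j

  notAt-A : ∀ a j → notAt (A a) j ≡ true
  notAt-A a j = cong not (dec-false (A a ≟ B j) (left≢right a j))

  notAt-self : ∀ j → notAt (B j) j ≡ false
  notAt-self j = cong not (dec-true (B j ≟ B j) refl)

  notAt-other : ∀ {j′ j} → j′ ≢ j → notAt (B j′) j ≡ true
  notAt-other j′≢j = cong not (dec-false (_ ≟ _) (j′≢j ∘ ↑ʳ-injective 3 _ _))

  tally : List (V × V) → V → V → Mask → ℕ
  tally U vm vo m = count λ j → vacant vm vo j ∧ (mask U j ==ᴹ m)

  record Tallies (U : List (V × V)) (vm vo : V) (c : Count) : Set where
    constructor tallied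
    field tally≡ : ∀ m → tally U vm vo m ≡ c m

  tally-enter : ∀ U a j₀ vo m →
    tally ((A a , B j₀) ∷ U) vo (B j₀) m + indicator (notAt vo j₀ ∧ (mask U j₀ ==ᴹ m)) ≡ tally U (A a) vo m
  tally-enter U a j₀ vo m = begin
    count P′ + indicator (notAt vo j₀ ∧ (mask U j₀ ==ᴹ m)) ≡⟨ cong (λ b → count P′ + indicator b) (sym P-at) ⟩
    count P′ + indicator (P j₀)                            ≡⟨ count-change P P′ j₀ agree ⟩
    count P + indicator (P′ j₀)                            ≡⟨ cong (λ b → count P + indicator b) P′-at ⟩
    count P + 0                                            ≡⟨ +-identityʳ (count P) ⟩
    count P                                                ∎
    where
    U′ : List (V × V)
    U′ = (A a , B j₀) ∷ U
    P P′ : Fin q → Bool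
    P  j = vacant (A a) vo j ∧ (mask U j ==ᴹ m)
    P′ j = vacant vo (B j₀) j ∧ (mask U′ j ==ᴹ m)
    agree : ∀ j → j ≢ j₀ → P j ≡ P′ j
    agree j j≢j₀ = cong₂ _∧_ vacancy (cong (_==ᴹ m) (sym (mask-elsewhere {U} {a} (inj₁ refl) j≢j₀)))
      where
      vacancy : vacant (A a) vo j ≡ vacant vo (B j₀) j
      vacancy = trans (cong (_∧ notAt vo j) (notAt-A a j))
                      (sym (trans (cong (notAt vo j ∧_) (notAt-other (≢-sym j≢j₀))) (∧-identityʳ _)))
    P-at : P j₀ ≡ notAt vo j₀ ∧ (mask U j₀ ==ᴹ m)
    P-at = cong (λ b → (b ∧ notAt vo j₀) ∧ (mask U j₀ ==ᴹ m)) (notAt-A a j₀)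
    P′-at : P′ j₀ ≡ false
    P′-at rewrite notAt-self j₀ | ∧-zeroʳ (notAt vo j₀) = refl

  tally-leave : ∀ U a j₀ vo m →
    tally ((B j₀ , A a) ∷ U) vo (A a) m ≡ tally U (B j₀) vo m + indicator (notAt vo j₀ ∧ (delete (mask U j₀) a ==ᴹ m))
  tally-leave U a j₀ vo m = begin
    count P′                    ≡⟨ sym (+-identityʳ (count P′)) ⟩
    count P′ + 0                ≡⟨ cong (λ b → count P′ + indicator b) (sym P-at) ⟩
    count P′ + indicator (P j₀) ≡⟨ count-change P P′ j₀ agree ⟩
    count P + indicator (P′ j₀) ≡⟨ cong (λ b → count P + indicator b) P′-at ⟩
    count P + indicator (notAt vo j₀ ∧ (delete (mask U j₀) a ==ᴹ m)) ∎
    where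
    U′ : List (V × V)
    U′ = (B j₀ , A a) ∷ U
    P P′ : Fin q → Bool
    P  j = vacant (B j₀) vo j ∧ (mask U j ==ᴹ m)
    P′ j = vacant vo (A a) j ∧ (mask U′ j ==ᴹ m)
    agree : ∀ j → j ≢ j₀ → P j ≡ P′ j
    agree j j≢j₀ = cong₂ _∧_ vacancy (cong (_==ᴹ m) (sym (mask-elsewhere {U} {a} (inj₂ refl) j≢j₀)))
      where
      vacancy : vacant (B j₀) vo j ≡ vacant vo (A a) j
      vacancy = trans (cong (_∧ notAt vo j) (notAt-other (≢-sym j≢j₀)))
                      (sym (trans (cong (notAt vo j ∧_) (notAt-A a j)) (∧-identityʳ _)))
    P-at : P j₀ ≡ false
    P-at rewrite notAt-self j₀ = refl
    P′-at : P′ j₀ ≡ notAt vo j₀ ∧ (delete (mask U j₀) a ==ᴹ m)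
    P′-at = trans (cong₂ (λ b mₙ → (notAt vo j₀ ∧ b) ∧ (mₙ ==ᴹ m)) (notAt-A a j₀) (mask-inserted {U} {a} (inj₂ refl)))
                  (cong (_∧ (delete (mask U j₀) a ==ᴹ m)) (∧-identityʳ (notAt vo j₀)))

  tallies-enter : ∀ {U a j vo c} → notAt vo j ≡ true → Tallies U (A a) vo c →
                  Tallies ((A a , B j) ∷ U) vo (B j) (occupy (mask U j) c)
  tallies-enter {U} {a} {j} {vo} vacant (tallied tallies) = tallied λ m → drop-indicator (mask U j ==ᴹ m)
    (trans (cong (λ b → tally ((A a , B j) ∷ U) vo (B j) m + indicator (b ∧ (mask U j ==ᴹ m))) (sym vacant))
           (trans (tally-enter U a j vo m) (tallies m)))

  tallies-join : ∀ {U a j c} → Tallies U (A a) (B j) c → Tallies ((A a , B j) ∷ U) (B j) (B j) c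
  tallies-join {U} {a} {j} (tallied tallies) = tallied λ m → drop-indicator false
    (trans (cong (λ b → tally ((A a , B j) ∷ U) (B j) (B j) m + indicator (b ∧ (mask U j ==ᴹ m))) (sym (notAt-self j)))
           (trans (tally-enter U a j (B j) m) (tallies m)))

  tallies-leave : ∀ {U a j vo c} → notAt vo j ≡ true → Tallies U (B j) vo c →
                  Tallies ((B j , A a) ∷ U) vo (A a) (release (delete (mask U j) a) c)
  tallies-leave {U} {a} {j} {vo} vacant (tallied tallies) = tallied λ m → add-indicator (delete (mask U j) a ==ᴹ m)
    (trans (tally-leave U a j vo m)
           (cong₂ (λ t b → t + indicator (b ∧ (delete (mask U j) a ==ᴹ m))) (tallies m) vacant))

  tallies-leave-shared : ∀ {U a j c} → Tallies U (B j) (B j) c → Tallies ((B j , A a) ∷ U) (B j) (A a) c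
  tallies-leave-shared {U} {a} {j} (tallied tallies) = tallied λ m → add-indicator false
    (trans (tally-leave U a j (B j) m)
           (cong₂ (λ t b → t + indicator (b ∧ (delete (mask U j) a ==ᴹ m))) (tallies m) (notAt-self j)))

  Places : List (V × V) → V → V → Position → Set
  Places U vm vo (AA a b)   = vm ≡ A a × vo ≡ A b
  Places U vm vo (AB a m)   = vm ≡ A a × ∃ λ j → vo ≡ B j × mask U j ≡ m
  Places U vm vo (BA m b)   = (∃ λ j → vm ≡ B j × mask U j ≡ m) × vo ≡ A b
  Places U vm vo (BB m m′)  = ∃₂ λ j j′ → vm ≡ B j × vo ≡ B j′ × j ≢ j′ × mask U j ≡ m × mask U j′ ≡ m′
  Places U vm vo (shared m) = ∃ λ j → vm ≡ B j × vo ≡ B j × mask U j ≡ m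

  Abstracts : List (V × V) → V → V → State → Set
  Abstracts U vm vo (st c p) = Places U vm vo p × Tallies U vm vo c

  unused⇒has : ∀ {U a} j → ¬ Used U (A a) (B j) → has (mask U j) a ≡ true
  unused⇒has {U} {a} j unused = trans (has-mask U j a) (unused⇒free unused)

  has⇒unused : ∀ {U a} j → has (mask U j) a ≡ true → ¬ Used U (A a) (B j)
  has⇒unused {U} {a} j h = free⇒unused (trans (sym (has-mask U j a)) h)

  vacant⇒positive : ∀ {U vm vo c} j → vacant vm vo j ≡ true → Tallies U vm vo c →
                    ∃ λ n → c (mask U j) ≡ suc n
  vacant⇒positive {U} {vm} {vo} j vac (tallied tallies)
    with count-positive (λ j′ → vacant vm vo j′ ∧ (mask U j′ ==ᴹ mask U j)) j
                        (cong₂ _∧_ vac (dec-true (mask U j ≟ᴹ mask U j) refl))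
  ... | n , eq = n , trans (sym (tallies (mask U j))) eq

  positive⇒vacant : ∀ {U vm vo c m n} → Tallies U vm vo c → c m ≡ suc n →
                    ∃ λ j → vacant vm vo j ≡ true × mask U j ≡ m
  positive⇒vacant {U} {vm} {vo} {m = m} (tallied tallies) eq
    with count-witness (λ j → vacant vm vo j ∧ (mask U j ==ᴹ m)) (trans (tallies m) eq)
  ... | j , Pj with ∧-true⁻ Pj
  ...   | vac , same = j , vac , ==ᴹ⇒≡ same

  vacant-AA : ∀ a b j → vacant (A a) (A b) j ≡ true
  vacant-AA a b j = cong₂ _∧_ (notAt-A a j) (notAt-A b j)

  vacant-AB : ∀ {j′ j} a → j′ ≢ j → vacant (A a) (B j′) j ≡ true
  vacant-AB a j′≢j = cong₂ _∧_ (notAt-A a _) (notAt-other j′≢j)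

  vacant-AB⁻ : ∀ {j′ j} a → vacant (A a) (B j′) j ≡ true → j′ ≢ j
  vacant-AB⁻ {j′} a vac refl with () ← trans (sym (proj₂ (∧-true⁻ {notAt (A a) j′} vac))) (notAt-self j′)

  abstract-step : ∀ {U vm vo w} s → Abstracts U vm vo s → Adj vm w → ¬ Used U vm w →
                  ∃ λ s′ → Step s s′ × Abstracts ((vm , w) ∷ U) vo w s′
  abstract-step {U} {w = w} (st c (AA a b)) ((refl , refl) , tallies) adj unused with side w
  ... | left a′ = ⊥-elim (left-left-¬adj a a′ adj)
  ... | right j with vacant⇒positive j (vacant-AA a b j) tallies
  ...   | n , eq = _ , enterᴬᴬ (mask U j) (unused⇒has j unused) n eq ,
                   (refl , j , refl , mask-inserted {U} {a} (inj₁ refl)) , tallies-enter (notAt-A b j) tallies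
  abstract-step {U} {w = w} (st c (AB a _)) ((refl , j′ , refl , refl) , tallies) adj unused with side w
  ... | left a′ = ⊥-elim (left-left-¬adj a a′ adj)
  ... | right j with j′ ≟ j
  ...   | yes refl = _ , joinᴬᴮ (unused⇒has j unused) ,
                     (j , refl , refl , mask-inserted {U} {a} (inj₁ refl)) , tallies-join tallies
  ...   | no j′≢j with vacant⇒positive j (vacant-AB a j′≢j) tallies
  ...     | n , eq = _ , enterᴬᴮ (mask U j) (unused⇒has j unused) n eq ,
                     (j′ , j , refl , refl , j′≢j , mask-elsewhere {U} {a} (inj₁ refl) j′≢j , mask-inserted {U} {a} (inj₁ refl)) ,
                     tallies-enter (notAt-other j′≢j) tallies
  abstract-step {U} {w = w} (st c (BA _ b)) (((j , refl , refl) , refl) , tallies) adj unused with side w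
  ... | right j′ = ⊥-elim (right-right-¬adj j j′ adj)
  ... | left a = _ , leaveᴮᴬ a (unused⇒has j (unused ∘ Used-flip)) ,
                 (refl , refl) , tallies-leave (notAt-A b j) tallies
  abstract-step {U} {w = w} (st c (BB _ _)) ((j , j′ , refl , refl , j≢j′ , refl , refl) , tallies) adj unused
    with side w
  ... | right j″ = ⊥-elim (right-right-¬adj j j″ adj)
  ... | left a = _ , leaveᴮᴮ a (unused⇒has j (unused ∘ Used-flip)) ,
                 ((j′ , refl , mask-elsewhere {U} {a} (inj₂ refl) (≢-sym j≢j′)) , refl) ,
                 tallies-leave (notAt-other (≢-sym j≢j′)) tallies
  abstract-step {U} {w = w} (st c (shared _)) ((j , refl , refl , refl) , tallies) adj unused with side w
  ... | right j′ = ⊥-elim (right-right-¬adj j j′ adj)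
  ... | left a = _ , leaveShared a (unused⇒has j (unused ∘ Used-flip)) ,
                 ((j , refl , mask-inserted {U} {a} (inj₂ refl)) , refl) , tallies-leave-shared tallies

  concrete-move : ∀ {U vm vo} s s′ → Abstracts U vm vo s → Step s s′ →
                  ∃ λ w → Adj vm w × ¬ Used U vm w × Abstracts ((vm , w) ∷ U) vo w s′
  concrete-move {U} (st c (AA a b)) _ ((refl , refl) , tallies) (enterᴬᴬ m h n eq)
    with positive⇒vacant tallies eq
  ... | j , vac , refl = B j , left-right-adj a j , has⇒unused j h ,
                         (refl , j , refl , mask-inserted {U} {a} (inj₁ refl)) , tallies-enter (notAt-A b j) tallies
  concrete-move {U} (st c (AB a _)) _ ((refl , j′ , refl , refl) , tallies) (enterᴬᴮ m h n eq)
    with positive⇒vacant tallies eq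
  ... | j , vac , refl = B j , left-right-adj a j , has⇒unused j h ,
                         (j′ , j , refl , refl , j′≢j , mask-elsewhere {U} {a} (inj₁ refl) j′≢j ,
                          mask-inserted {U} {a} (inj₁ refl)) ,
                         tallies-enter (notAt-other j′≢j) tallies
    where
    j′≢j : j′ ≢ j
    j′≢j = vacant-AB⁻ a vac
  concrete-move {U} (st c (AB a _)) _ ((refl , j , refl , refl) , tallies) (joinᴬᴮ h) =
    B j , left-right-adj a j , has⇒unused j h ,
    (j , refl , refl , mask-inserted {U} {a} (inj₁ refl)) , tallies-join tallies
  concrete-move {U} (st c (BA _ b)) _ (((j , refl , refl) , refl) , tallies) (leaveᴮᴬ a h) =
    A a , right-left-adj a j , has⇒unused j h ∘ Used-flip ,
    (refl , refl) , tallies-leave (notAt-A b j) tallies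
  concrete-move {U} (st c (BB _ _)) _ ((j , j′ , refl , refl , j≢j′ , refl , refl) , tallies) (leaveᴮᴮ a h) =
    A a , right-left-adj a j , has⇒unused j h ∘ Used-flip ,
    ((j′ , refl , mask-elsewhere {U} {a} (inj₂ refl) (≢-sym j≢j′)) , refl) ,
    tallies-leave (notAt-other (≢-sym j≢j′)) tallies
  concrete-move {U} (st c (shared _)) _ ((j , refl , refl , refl) , tallies) (leaveShared a h) =
    A a , right-left-adj a j , has⇒unused j h ∘ Used-flip ,
    ((j , refl , mask-inserted {U} {a} (inj₂ refl)) , refl) , tallies-leave-shared tallies

  Wins⇒Win : ∀ {U vm vo} s → Abstracts U vm vo s → Wins s → Win U vm vo
  Loses⇒Lose : ∀ {U vm vo} s → Abstracts U vm vo s → Loses s → Lose U vm vo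

  Wins⇒Win s abs (play s′ step loses) with concrete-move s s′ abs step
  ... | w , adj , unused , abs′ = move w adj unused (Loses⇒Lose s′ abs′ loses)

  Loses⇒Lose s abs (every wins) = stuck-or-all λ w adj unused →
    let (s′ , step , abs′) = abstract-step s abs adj unused in Wins⇒Win s′ abs′ (wins s′ step)

-- Strategies in the abstract game

fresh spent : Mask
fresh = ⟨ true , true , true ⟩
spent = ⟨ false , false , false ⟩

deadEnd : Fin 3 → Mask
deadEnd 0F = ⟨ true , false , false ⟩
deadEnd 1F = ⟨ false , true , false ⟩
deadEnd 2F = ⟨ false , false , true ⟩

data IsPath : Mask → Set where
  path₀₁ : IsPath ⟨ true , true , false ⟩
  path₀₂ : IsPath ⟨ true , false , true ⟩
  path₁₂ : IsPath ⟨ false , true , true ⟩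

record PathFree (c : Count) : Set where
  constructor pathFree
  field
    none₀₁ : c ⟨ true , true , false ⟩ ≡ 0
    none₀₂ : c ⟨ true , false , true ⟩ ≡ 0
    none₁₂ : c ⟨ false , true , true ⟩ ≡ 0

absent : ∀ {c m} → PathFree c → IsPath m → c m ≡ 0
absent (pathFree n₀₁ _ _) path₀₁ = n₀₁
absent (pathFree _ n₀₂ _) path₀₂ = n₀₂
absent (pathFree _ _ n₁₂) path₁₂ = n₁₂

pathFree-from : ∀ {c} → (∀ {m} → IsPath m → c m ≡ 0) → PathFree c
pathFree-from none = pathFree (none path₀₁) (none path₀₂) (none path₁₂)

data Entry (a : Fin 3) : Mask → Set where
  via-fresh   : Entry a fresh
  via-path    : ∀ {m} → IsPath m → Entry a m
  via-deadEnd : Entry a (deadEnd a)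

entry : ∀ m a → has m a ≡ true → Entry a m
entry ⟨ true  , true  , true  ⟩ _  _ = via-fresh
entry ⟨ true  , true  , false ⟩ _  _ = via-path path₀₁
entry ⟨ true  , false , true  ⟩ _  _ = via-path path₀₂
entry ⟨ false , true  , true  ⟩ _  _ = via-path path₁₂
entry ⟨ true  , false , false ⟩ 0F _ = via-deadEnd
entry ⟨ false , true  , false ⟩ 1F _ = via-deadEnd
entry ⟨ false , false , true  ⟩ 2F _ = via-deadEnd
entry ⟨ true  , false , false ⟩ 1F ()
entry ⟨ true  , false , false ⟩ 2F ()
entry ⟨ false , true  , false ⟩ 0F ()
entry ⟨ false , true  , false ⟩ 2F ()
entry ⟨ false , false , true  ⟩ 0F ()
entry ⟨ false , false , true  ⟩ 1F ()
entry ⟨ false , false , false ⟩ 0F ()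
entry ⟨ false , false , false ⟩ 1F ()
entry ⟨ false , false , false ⟩ 2F ()

has-fresh : ∀ a → has fresh a ≡ true
has-fresh 0F = refl
has-fresh 1F = refl
has-fresh 2F = refl

has-deadEnd : ∀ a → has (deadEnd a) a ≡ true
has-deadEnd 0F = refl
has-deadEnd 1F = refl
has-deadEnd 2F = refl

spent-empty : ∀ a → has spent a ≢ true
spent-empty 0F ()
spent-empty 1F ()
spent-empty 2F ()

deadEnd-exhausted : ∀ a → delete (deadEnd a) a ≡ spent
deadEnd-exhausted 0F = refl
deadEnd-exhausted 1F = refl
deadEnd-exhausted 2F = refl

has-fresh-minus : ∀ {a x} → a ≢ x → has (delete fresh a) x ≡ true
has-fresh-minus {a} {x} a≢x = trans (has-delete-other fresh (≢-sym a≢x)) (has-fresh x)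

has-fresh-minus⁻ : ∀ {a x} → has (delete fresh a) x ≡ true → a ≢ x
has-fresh-minus⁻ {a} h refl with () ← trans (sym h) (has-delete-same fresh a)

third : Fin 3 → Fin 3 → Fin 3
third 0F 1F = 2F
third 1F 0F = 2F
third 0F 2F = 1F
third 2F 0F = 1F
third 1F 2F = 0F
third 2F 1F = 0F
third 0F 0F = 1F
third 1F 1F = 0F
third 2F 2F = 0F

other : Fin 3 → Fin 3
other a = third a a

other-≢ : ∀ a → a ≢ other a
other-≢ 0F ()
other-≢ 1F ()
other-≢ 2F ()

third-≢ˡ : ∀ {a x} → a ≢ x → third a x ≢ a
third-≢ˡ {0F} {0F} a≢x = ⊥-elim (a≢x refl)
third-≢ˡ {1F} {1F} a≢x = ⊥-elim (a≢x refl)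
third-≢ˡ {2F} {2F} a≢x = ⊥-elim (a≢x refl)
third-≢ˡ {0F} {1F} _ ()
third-≢ˡ {0F} {2F} _ ()
third-≢ˡ {1F} {0F} _ ()
third-≢ˡ {1F} {2F} _ ()
third-≢ˡ {2F} {0F} _ ()
third-≢ˡ {2F} {1F} _ ()

third-comm : ∀ a b → third a b ≡ third b a
third-comm 0F 0F = refl
third-comm 0F 1F = refl
third-comm 0F 2F = refl
third-comm 1F 0F = refl
third-comm 1F 1F = refl
third-comm 1F 2F = refl
third-comm 2F 0F = refl
third-comm 2F 1F = refl
third-comm 2F 2F = refl

third-≢ʳ : ∀ {a x} → a ≢ x → third a x ≢ x
third-≢ʳ {a} {x} a≢x eq = third-≢ˡ (≢-sym a≢x) (trans (third-comm x a) eq)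

third-unique : ∀ {a b x} → a ≢ b → x ≢ a → x ≢ b → x ≡ third a b
third-unique {0F} {1F} {2F} _ _ _ = refl
third-unique {0F} {2F} {1F} _ _ _ = refl
third-unique {1F} {0F} {2F} _ _ _ = refl
third-unique {1F} {2F} {0F} _ _ _ = refl
third-unique {2F} {0F} {1F} _ _ _ = refl
third-unique {2F} {1F} {0F} _ _ _ = refl
third-unique {0F} {0F} a≢b _ _ = ⊥-elim (a≢b refl)
third-unique {1F} {1F} a≢b _ _ = ⊥-elim (a≢b refl)
third-unique {2F} {2F} a≢b _ _ = ⊥-elim (a≢b refl)
third-unique {0F} {1F} {0F} _ x≢a _ = ⊥-elim (x≢a refl)
third-unique {0F} {1F} {1F} _ _ x≢b = ⊥-elim (x≢b refl)
third-unique {0F} {2F} {0F} _ x≢a _ = ⊥-elim (x≢a refl)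
third-unique {0F} {2F} {2F} _ _ x≢b = ⊥-elim (x≢b refl)
third-unique {1F} {0F} {1F} _ x≢a _ = ⊥-elim (x≢a refl)
third-unique {1F} {0F} {0F} _ _ x≢b = ⊥-elim (x≢b refl)
third-unique {1F} {2F} {1F} _ x≢a _ = ⊥-elim (x≢a refl)
third-unique {1F} {2F} {2F} _ _ x≢b = ⊥-elim (x≢b refl)
third-unique {2F} {0F} {2F} _ x≢a _ = ⊥-elim (x≢a refl)
third-unique {2F} {0F} {0F} _ _ x≢b = ⊥-elim (x≢b refl)
third-unique {2F} {1F} {2F} _ x≢a _ = ⊥-elim (x≢a refl)
third-unique {2F} {1F} {1F} _ _ x≢b = ⊥-elim (x≢b refl)

fresh-minus-two : ∀ {a x} → a ≢ x → delete (delete fresh a) x ≡ deadEnd (third a x)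
fresh-minus-two {0F} {1F} _ = refl
fresh-minus-two {0F} {2F} _ = refl
fresh-minus-two {1F} {0F} _ = refl
fresh-minus-two {1F} {2F} _ = refl
fresh-minus-two {2F} {0F} _ = refl
fresh-minus-two {2F} {1F} _ = refl
fresh-minus-two {0F} {0F} a≢x = ⊥-elim (a≢x refl)
fresh-minus-two {1F} {1F} a≢x = ⊥-elim (a≢x refl)
fresh-minus-two {2F} {2F} a≢x = ⊥-elim (a≢x refl)

has-third : ∀ {a x} → a ≢ x → has (delete (delete fresh a) x) (third a x) ≡ true
has-third {a} {x} a≢x = subst (λ m → has m (third a x) ≡ true) (sym (fresh-minus-two a≢x)) (has-deadEnd (third a x))

fresh-minus-all : ∀ {a x} → a ≢ x → delete (delete (delete fresh a) x) (third a x) ≡ spent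
fresh-minus-all {a} {x} a≢x =
  trans (cong (λ m → delete m (third a x)) (fresh-minus-two a≢x)) (deadEnd-exhausted (third a x))

deadEnd-injective : ∀ {x v} → deadEnd x ≡ deadEnd v → x ≡ v
deadEnd-injective {0F} {0F} _ = refl
deadEnd-injective {1F} {1F} _ = refl
deadEnd-injective {2F} {2F} _ = refl
deadEnd-injective {0F} {1F} ()
deadEnd-injective {0F} {2F} ()
deadEnd-injective {1F} {0F} ()
deadEnd-injective {1F} {2F} ()
deadEnd-injective {2F} {0F} ()
deadEnd-injective {2F} {1F} ()

fresh≢deadEnd : ∀ v → fresh ≢ deadEnd v
fresh≢deadEnd 0F ()
fresh≢deadEnd 1F ()
fresh≢deadEnd 2F ()

deadEnd≢path : ∀ {m} x → IsPath m → deadEnd x ≢ m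
deadEnd≢path 0F path₀₁ ()
deadEnd≢path 0F path₀₂ ()
deadEnd≢path 0F path₁₂ ()
deadEnd≢path 1F path₀₁ ()
deadEnd≢path 1F path₀₂ ()
deadEnd≢path 1F path₁₂ ()
deadEnd≢path 2F path₀₁ ()
deadEnd≢path 2F path₀₂ ()
deadEnd≢path 2F path₁₂ ()

fresh≢path : ∀ {m} → IsPath m → fresh ≢ m
fresh≢path path₀₁ ()
fresh≢path path₀₂ ()
fresh≢path path₁₂ ()

-- The counts after a round in which the mover enters a fresh vertex from a, the opponent
-- another one from b, and they leave through x and y respectively.
afterRound : Count → Fin 3 → Fin 3 → Fin 3 → Fin 3 → Count
afterRound c a x b y =
  release (delete (delete fresh b) y) (release (delete (delete fresh a) x) (occupy fresh (occupy fresh c)))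

module _ (c : Count) {a x b y : Fin 3} (a≢x : a ≢ x) (b≢y : b ≢ y) where

  private
    base : Count
    base = occupy fresh (occupy fresh c)

    base-deadEnd : ∀ v → base (deadEnd v) ≡ c (deadEnd v)
    base-deadEnd v = trans (occupy-other (occupy fresh c) (fresh≢deadEnd v)) (occupy-other c (fresh≢deadEnd v))

    round-shape : afterRound c a x b y ≡ release (deadEnd (third b y)) (release (deadEnd (third a x)) base)
    round-shape rewrite fresh-minus-two a≢x | fresh-minus-two b≢y = refl

  afterRound-fresh : ∀ {n} → c fresh ≡ 2 + n → afterRound c a x b y fresh ≡ n
  afterRound-fresh eq = trans (cong-app round-shape fresh) $
    trans (release-other (release (deadEnd (third a x)) base) (≢-sym (fresh≢deadEnd (third b y))))
      (trans (release-other base (≢-sym (fresh≢deadEnd (third a x))))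
        (trans (occupy-same fresh (occupy fresh c)) (cong pred (trans (occupy-same fresh c) (cong pred eq)))))

  afterRound-PathFree : PathFree c → PathFree (afterRound c a x b y)
  afterRound-PathFree paths = pathFree-from λ p → trans (cong-app round-shape _) $
    trans (release-other (release (deadEnd (third a x)) base) (deadEnd≢path (third b y) p))
      (trans (release-other base (deadEnd≢path (third a x) p))
        (trans (occupy-other (occupy fresh c) (fresh≢path p)) (trans (occupy-other c (fresh≢path p)) (absent paths p))))

  afterRound-keeps : ∀ v → 1 ≤ c (deadEnd v) → 1 ≤ afterRound c a x b y (deadEnd v)
  afterRound-keeps v h = subst (1 ≤_) (sym (cong-app round-shape (deadEnd v))) $
    ≤-trans (subst (1 ≤_) (sym (base-deadEnd v)) h)
      (≤-trans (release-≥ (deadEnd (third a x)) base)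
               (release-≥ (deadEnd (third b y)) (release (deadEnd (third a x)) base)))

  afterRound-adds : 1 ≤ afterRound c a x b y (deadEnd (third a x))
  afterRound-adds = subst (1 ≤_) (sym (cong-app round-shape (deadEnd (third a x)))) $
    ≤-trans (subst (1 ≤_) (sym (release-same (deadEnd (third a x)) base)) (s≤s z≤n))
            (release-≥ (deadEnd (third b y)) (release (deadEnd (third a x)) base))

  afterRound-unchanged : ∀ v → third a x ≢ v → third b y ≢ v → afterRound c a x b y (deadEnd v) ≡ c (deadEnd v)
  afterRound-unchanged v ax≢v by≢v = trans (cong-app round-shape (deadEnd v)) $
    trans (release-other (release (deadEnd (third a x)) base) (by≢v ∘ deadEnd-injective))
      (trans (release-other base (ax≢v ∘ deadEnd-injective)) (base-deadEnd v))

afterRound-twice : ∀ {c a b} (a≢b : a ≢ b) → 2 ≤ afterRound c a b b a (deadEnd (third b a))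
afterRound-twice {c} {a} {b} a≢b
  rewrite fresh-minus-two a≢b | fresh-minus-two (≢-sym a≢b) | third-comm a b
        | release-same (deadEnd (third b a)) (release (deadEnd (third b a)) (occupy fresh (occupy fresh c)))
        | release-same (deadEnd (third b a)) (occupy fresh (occupy fresh c)) = s≤s (s≤s z≤n)

stuckᴮᴬ : ∀ {c m x} → m ≡ spent → Loses (st c (BA m x))
stuckᴮᴬ refl = every λ { _ (leaveᴮᴬ y h) → ⊥-elim (spent-empty y h) }

stuckᴮᴮ : ∀ {c m m′} → m ≡ spent → Loses (st c (BB m m′))
stuckᴮᴮ refl = every λ { _ (leaveᴮᴮ y h) → ⊥-elim (spent-empty y h) }

path-closed : ∀ {c m n} → PathFree c → IsPath m → c m ≢ suc n
path-closed paths p eq with () ← trans (sym (absent paths p)) eq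

occupy-fresh-PathFree : ∀ {c} → PathFree c → PathFree (occupy fresh c)
occupy-fresh-PathFree {c} paths = pathFree-from λ p → trans (occupy-other c (fresh≢path p)) (absent paths p)

odd-fresh-wins : ∀ k {c} a b → c fresh ≡ suc (k + k) → PathFree c → Wins (st c (AA a b))
odd-fresh-wins k {c} a b odd paths = play _ (enterᴬᴬ fresh (has-fresh a) (k + k) odd) (every reply)
  where
  continue : ∀ k {n} → c fresh ≡ suc (k + k) → occupy fresh c fresh ≡ suc n →
             Wins (st (occupy fresh (occupy fresh c)) (BB (delete fresh a) (delete fresh b)))
  continue zero odd eq with () ← trans (sym (trans (occupy-same fresh c) (cong pred odd))) eq
  continue (suc k′) odd _ = play _ (leaveᴮᴮ (other a) (has-fresh-minus (other-≢ a))) (every λ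
    { _ (leaveᴮᴬ y hy) → let b≢y = has-fresh-minus⁻ {b} {y} hy in
        odd-fresh-wins k′ (other a) y
          (trans (afterRound-fresh c (other-≢ a) b≢y odd) (+-suc k′ k′))
          (afterRound-PathFree c (other-≢ a) b≢y paths) })

  reply : ∀ s′ → Step (st (occupy fresh c) (AB b (delete fresh a))) s′ → Wins s′
  reply _ (enterᴬᴮ m h n eq) with entry m b h
  ... | via-path p  = ⊥-elim (path-closed (occupy-fresh-PathFree paths) p eq)
  ... | via-deadEnd = play _ (leaveᴮᴮ (other a) (has-fresh-minus (other-≢ a))) (stuckᴮᴬ (deadEnd-exhausted b))
  ... | via-fresh   = continue k odd eq
  reply _ (joinᴬᴮ h) = play _ (leaveShared (third a b) (has-third a≢b)) (stuckᴮᴬ (fresh-minus-all a≢b))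
    where
    a≢b : a ≢ b
    a≢b = has-fresh-minus⁻ {a} {b} h

-- Whenever the player at x enters a dead end, the player at y can enter one as well.
EndgameSafe : Count → Fin 3 → Fin 3 → Set
EndgameSafe c x y = (x ≢ y × 1 ≤ c (deadEnd y)) ⊎ (x ≡ y × (c (deadEnd x) ≡ 0 ⊎ 2 ≤ c (deadEnd x)))

no-fresh-loses : ∀ {c x y} → c fresh ≡ 0 → PathFree c → EndgameSafe c x y → Loses (st c (AA x y))
no-fresh-loses {c} {x} {y} none paths safe = every reply
  where
  positive : ∀ {t} → 1 ≤ t → t ≡ suc (pred t)
  positive {suc _} _ = refl

  answer : ∀ {n} → EndgameSafe c x y → c (deadEnd x) ≡ suc n →
           Wins (st (occupy (deadEnd x) c) (AB y (delete (deadEnd x) x)))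
  answer (inj₁ (x≢y , ≥1)) _ =
    play _ (enterᴬᴮ (deadEnd y) (has-deadEnd y) _ (trans (occupy-other c (x≢y ∘ deadEnd-injective)) (positive ≥1)))
         (stuckᴮᴮ (deadEnd-exhausted x))
  answer (inj₂ (refl , inj₁ none-left)) eq with () ← trans (sym none-left) eq
  answer (inj₂ (refl , inj₂ ≥2)) _ =
    play _ (enterᴬᴮ (deadEnd x) (has-deadEnd x) _ (trans (occupy-same (deadEnd x) c) (positive (pred-mono-≤ ≥2))))
         (stuckᴮᴮ (deadEnd-exhausted x))

  reply : ∀ s′ → Step (st c (AA x y)) s′ → Wins s′
  reply _ (enterᴬᴬ m h n eq) with entry m x h
  ... | via-fresh   with () ← trans (sym none) eq
  ... | via-path p  = ⊥-elim (path-closed paths p eq)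
  ... | via-deadEnd = answer safe eq

-- Enough for the opponent to choose an exit of the last round that makes the endgame safe.
EvenSafe : Count → Fin 3 → Fin 3 → ℕ → Set
EvenSafe c a b k =
  a ≡ b ⊎ 1 ≤ k ⊎ 1 ≤ c (deadEnd a) ⊎ c (deadEnd (third a b)) ≡ 0 ⊎ 2 ≤ c (deadEnd (third a b))

even-fresh-loses : ∀ k {c} a b → c fresh ≡ suc (suc (k + k)) → PathFree c → EvenSafe c a b k →
                   Loses (st c (AA a b))
even-fresh-loses k {c} a b even paths safe = every reply
  where
  Reply : Fin 3 → Set
  Reply x = Wins (st (release (delete (delete fresh a) x) (occupy fresh (occupy fresh c))) (BA (delete fresh b) x))

  leave : ∀ {x} y → b ≢ y → Loses (st (afterRound c a x b y) (AA x y)) → Reply x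
  leave y b≢y loses = play _ (leaveᴮᴬ y (has-fresh-minus b≢y)) loses

  respond : ∀ k → c fresh ≡ suc (suc (k + k)) → EvenSafe c a b k → ∀ x → a ≢ x → Reply x
  respond (suc k′) even _ x a≢x with x ≟ b
  ... | no x≢b = leave x (≢-sym x≢b)
        (even-fresh-loses k′ x x fewer (afterRound-PathFree c a≢x (≢-sym x≢b) paths) (inj₁ refl))
    where
    fewer : afterRound c a x b x fresh ≡ suc (suc (k′ + k′))
    fewer = trans (afterRound-fresh c a≢x (≢-sym x≢b) even) (cong (1 +_) (+-suc k′ k′))
  ... | yes refl = leave a (≢-sym a≢x)
        (even-fresh-loses k′ b a fewer (afterRound-PathFree c a≢x (≢-sym a≢x) paths)
          (inj₂ (inj₂ (inj₂ (inj₂ (afterRound-twice {c} a≢x))))))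
    where
    fewer : afterRound c a b b a fresh ≡ suc (suc (k′ + k′))
    fewer = trans (afterRound-fresh c a≢x (≢-sym a≢x) even) (cong (1 +_) (+-suc k′ k′))
  respond zero two safe x a≢x with x ≟ b
  ... | yes refl = leave (third a b) b≢t
        (no-fresh-loses (afterRound-fresh c a≢x b≢t two) (afterRound-PathFree c a≢x b≢t paths)
          (inj₁ (b≢t , afterRound-adds c a≢x b≢t)))
    where
    b≢t : b ≢ third a b
    b≢t = ≢-sym (third-≢ʳ a≢x)
  ... | no x≢b with a ≟ b
  ...   | yes refl = leave (third a x) a≢t
          (no-fresh-loses (afterRound-fresh c a≢x a≢t two) (afterRound-PathFree c a≢x a≢t paths)
            (inj₁ (≢-sym (third-≢ʳ a≢x) , afterRound-adds c a≢x a≢t)))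
    where
    a≢t : a ≢ third a x
    a≢t = ≢-sym (third-≢ˡ a≢x)
  ...   | no a≢b = endgame safe
    where
    x-third : x ≡ third a b
    x-third = third-unique a≢b (≢-sym a≢x) x≢b

    endgame : EvenSafe c a b zero → Reply x
    endgame (inj₁ a≡b)                = ⊥-elim (a≢b a≡b)
    endgame (inj₂ (inj₁ ()))
    endgame (inj₂ (inj₂ (inj₁ ≥1)))   = leave a (≢-sym a≢b)
      (no-fresh-loses (afterRound-fresh c a≢x (≢-sym a≢b) two) (afterRound-PathFree c a≢x (≢-sym a≢b) paths)
        (inj₁ (≢-sym a≢x , afterRound-keeps c a≢x (≢-sym a≢b) a ≥1)))
    endgame (inj₂ (inj₂ (inj₂ none-or-two))) = leave x (≢-sym x≢b)
      (no-fresh-loses (afterRound-fresh c a≢x (≢-sym x≢b) two) (afterRound-PathFree c a≢x (≢-sym x≢b) paths)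
        (inj₂ (refl , Sum.map (trans unchanged) (subst (2 ≤_) (sym unchanged)) none-or-two)))
      where
      unchanged : afterRound c a x b x (deadEnd x) ≡ c (deadEnd (third a b))
      unchanged = trans (afterRound-unchanged c a≢x (≢-sym x≢b) x (third-≢ʳ a≢x) (third-≢ʳ (≢-sym x≢b)))
                        (cong (c ∘ deadEnd) x-third)

  reply : ∀ s′ → Step (st c (AA a b)) s′ → Wins s′
  reply _ (enterᴬᴬ m h n eq) with entry m a h
  ... | via-path p  = ⊥-elim (path-closed paths p eq)
  ... | via-deadEnd = play _ (enterᴬᴮ fresh (has-fresh b) (suc (k + k)) (trans (occupy-other c (≢-sym (fresh≢deadEnd a))) even))
                             (stuckᴮᴮ (deadEnd-exhausted a))
  ... | via-fresh   = play _ (enterᴬᴮ fresh (has-fresh b) (k + k) (trans (occupy-same fresh c) (cong pred even)))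
                             (every λ { _ (leaveᴮᴮ x hx) → respond k even safe x (has-fresh-minus⁻ {a} {x} hx) })

-- Bounded exhaustive search

allBool : {P : Bool → Set} → (∀ b → Maybe (P b)) → Maybe (∀ b → P b)
allBool f with f true | f false
... | just t | just u = just λ { true → t ; false → u }
... | _      | _      = nothing

anyBool : {P : Bool → Set} → (∀ b → Maybe (P b)) → Maybe (∃ P)
anyBool f = map (true ,_) (f true) <∣> map (false ,_) (f false)

allMask : {P : Mask → Set} → (∀ m → Maybe (P m)) → Maybe (∀ m → P m)
allMask f = map (λ h → λ { ⟨ x , y , z ⟩ → h x y z })
                (allBool λ x → allBool λ y → allBool λ z → f ⟨ x , y , z ⟩)

anyMask : {P : Mask → Set} → (∀ m → Maybe (P m)) → Maybe (∃ P)
anyMask f = map (λ { (_ , _ , _ , p) → _ , p })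
                (anyBool λ x → anyBool λ y → anyBool λ z → f ⟨ x , y , z ⟩)

allFin : ∀ {n} {P : Fin n → Set} → (∀ i → Maybe (P i)) → Maybe (∀ (i : Fin n) → P i)
allFin {zero}  f = just λ ()
allFin {suc n} f with f zero | allFin (f ∘ suc)
... | just p | just ps = just λ { zero → p ; (suc i) → ps i }
... | _      | _       = nothing

anyFin : ∀ {n} {P : Fin n → Set} → (∀ i → Maybe (P i)) → Maybe (∃ λ (i : Fin n) → P i)
anyFin {zero}  f = nothing
anyFin {suc n} f = map (zero ,_) (f zero) <∣> map (λ { (i , p) → suc i , p }) (anyFin (f ∘ suc))

searchWin  : ℕ → (s : State) → Maybe (Wins s)
searchLose : ℕ → (s : State) → Maybe (Loses s)

enter-losing : ℕ → (c : Count) (a : Fin 3) (next : Mask → State) (m : Mask) →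
               Maybe (∃ λ (h : has m a ≡ true) → ∃ λ (n : ℕ) → ∃ λ (_ : c m ≡ suc n) → Loses (next m))
enter-losing fuel c a next m with has m a | c m
... | true | suc n = map (λ l → refl , n , refl , l) (searchLose fuel (next m))
... | _    | _     = nothing

enter-winning : ℕ → (c : Count) (a : Fin 3) (next : Mask → State) (m : Mask) →
                Maybe (has m a ≡ true → ∀ n → c m ≡ suc n → Wins (next m))
enter-winning fuel c a next m with has m a | c m
... | false | _     = just λ ()
... | true  | zero  = just λ _ _ ()
... | true  | suc _ = map (λ w _ _ _ → w) (searchWin fuel (next m))

leave-losing : ℕ → (m : Mask) (next : Fin 3 → State) (a : Fin 3) → Maybe (∃ λ (h : has m a ≡ true) → Loses (next a))
leave-losing fuel m next a with has m a
... | true  = map (refl ,_) (searchLose fuel (next a))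
... | false = nothing

leave-winning : ℕ → (m : Mask) (next : Fin 3 → State) (a : Fin 3) → Maybe (has m a ≡ true → Wins (next a))
leave-winning fuel m next a with has m a
... | false = just λ ()
... | true  = map (λ w _ → w) (searchWin fuel (next a))

searchWin zero s = nothing
searchWin (suc fuel) (st c (AA a b)) =
  map (λ { (m , h , n , eq , l) → play _ (enterᴬᴬ m h n eq) l })
      (anyMask (enter-losing fuel c a λ m → st (occupy m c) (AB b (delete m a))))
searchWin (suc fuel) (st c (AB a m′)) =
  joining <∣> map (λ { (m , h , n , eq , l) → play _ (enterᴬᴮ m h n eq) l })
                  (anyMask (enter-losing fuel c a λ m → st (occupy m c) (BB m′ (delete m a))))
  where
  joining : Maybe (Wins (st c (AB a m′)))
  joining with has m′ a in h
  ... | true  = map (play _ (joinᴬᴮ h)) (searchLose fuel (st c (shared (delete m′ a))))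
  ... | false = nothing
searchWin (suc fuel) (st c (BA m b)) =
  map (λ { (a , h , l) → play _ (leaveᴮᴬ a h) l })
      (anyFin (leave-losing fuel m λ a → st (release (delete m a) c) (AA b a)))
searchWin (suc fuel) (st c (BB m m′)) =
  map (λ { (a , h , l) → play _ (leaveᴮᴮ a h) l })
      (anyFin (leave-losing fuel m λ a → st (release (delete m a) c) (BA m′ a)))
searchWin (suc fuel) (st c (shared m)) =
  map (λ { (a , h , l) → play _ (leaveShared a h) l })
      (anyFin (leave-losing fuel m λ a → st c (BA (delete m a) a)))

searchLose zero s = nothing
searchLose (suc fuel) (st c (AA a b)) =
  map (λ w → every λ { _ (enterᴬᴬ m h n eq) → w m h n eq })
      (allMask (enter-winning fuel c a λ m → st (occupy m c) (AB b (delete m a))))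
searchLose (suc fuel) (st c (AB a m′)) with allMask (enter-winning fuel c a λ m → st (occupy m c) (BB m′ (delete m a)))
... | nothing = nothing
... | just w with has m′ a in h
...   | false = just (every λ { _ (enterᴬᴮ m h n eq) → w m h n eq ; _ (joinᴬᴮ h′) → ⊥-elim (cannot-join h h′) })
  where
  cannot-join : ∀ {b} → b ≡ false → b ≢ true
  cannot-join refl ()
...   | true = map (λ j → every λ { _ (enterᴬᴮ m h n eq) → w m h n eq ; _ (joinᴬᴮ _) → j })
                   (searchWin fuel (st c (shared (delete m′ a))))
searchLose (suc fuel) (st c (BA m b)) =
  map (λ w → every λ { _ (leaveᴮᴬ a h) → w a h })
      (allFin (leave-winning fuel m λ a → st (release (delete m a) c) (AA b a)))
searchLose (suc fuel) (st c (BB m m′)) =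
  map (λ w → every λ { _ (leaveᴮᴮ a h) → w a h })
      (allFin (leave-winning fuel m λ a → st (release (delete m a) c) (BA m′ a)))
searchLose (suc fuel) (st c (shared m)) =
  map (λ w → every λ { _ (leaveShared a h) → w a h })
      (allFin (leave-winning fuel m λ a → st c (BA (delete m a) a)))

freshOnly : ℕ → Count
freshOnly N m = if fresh ==ᴹ m then N else 0

freshOnly-PathFree : ∀ {N} → PathFree (freshOnly N)
freshOnly-PathFree = pathFree refl refl refl

opening-A-loses : ∀ k a → Loses (st (occupy fresh (freshOnly (5 + (k + k)))) (AB a (delete fresh 0F)))
opening-A-loses k a = every reply
  where
  c : Count
  c = occupy fresh (freshOnly (5 + (k + k)))

  deadEnd-absent : ∀ x → c (deadEnd x) ≡ 0
  deadEnd-absent 0F = refl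
  deadEnd-absent 1F = refl
  deadEnd-absent 2F = refl

  reply : ∀ s′ → Step (st c (AB a (delete fresh 0F))) s′ → Wins s′
  reply _ (enterᴬᴮ m h n eq) with entry m a h
  ... | via-path p  = ⊥-elim (path-closed (occupy-fresh-PathFree freshOnly-PathFree) p eq)
  ... | via-deadEnd = ⊥-elim (0≢1+n (trans (sym (deadEnd-absent a)) eq))
  ... | via-fresh   = play _ (leaveᴮᴮ 1F refl) (every λ
    { _ (leaveᴮᴬ y hy) → let a≢y = has-fresh-minus⁻ {a} {y} hy in
        odd-fresh-wins (suc k) 1F y
          (trans (afterRound-fresh (freshOnly (5 + (k + k))) {0F} {1F} (λ ()) a≢y refl) (cong (2 +_) (sym (+-suc k k))))
          (afterRound-PathFree (freshOnly (5 + (k + k))) {0F} {1F} (λ ()) a≢y freshOnly-PathFree) })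
  reply _ (joinᴬᴮ h) = play _ (leaveShared (third 0F a) (has-third 0≢a)) (stuckᴮᴬ (fresh-minus-all 0≢a))
    where
    0≢a : 0F ≢ a
    0≢a = has-fresh-minus⁻ {0F} {a} h

rounds-left-lose : ∀ k {c} a b → c fresh ≡ suc (suc (suc k + suc k)) → PathFree c → Loses (st c (AA a b))
rounds-left-lose k a b even paths = even-fresh-loses (suc k) a b even paths (inj₂ (inj₁ (s≤s z≤n)))

opening-shared-loses : ∀ k → Loses (st (freshOnly (4 + (k + k))) (shared (delete fresh 0F)))
opening-shared-loses k = every λ { _ (leaveShared a h) → let 0≢a = has-fresh-minus⁻ {0F} {a} h in
  play _ (leaveᴮᴬ (third 0F a) (has-third 0≢a))
    (subst (λ m → Loses (st (release m c) (AA a (third 0F a)))) (sym (fresh-minus-all 0≢a))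
      (rounds-left-lose k a (third 0F a) (cong (3 +_) (sym (+-suc k k)))
                         (pathFree refl refl refl))) }
  where
  c : Count
  c = freshOnly (4 + (k + k))

afterOpeningᴮ : ℕ → Fin 3 → State
afterOpeningᴮ k a = st (release (delete fresh a) (occupy fresh (freshOnly (4 + (k + k))))) (BA (delete fresh 0F) a)

opening-B-wins : ∀ k a → Wins (afterOpeningᴮ k a)
-- Only 13 edges of K_{3,5} are still unused, so fuel 14 makes the search exhaustive.
opening-B-wins zero 0F = from-just (searchWin 14 (afterOpeningᴮ 0 0F))
opening-B-wins zero 1F = from-just (searchWin 14 (afterOpeningᴮ 0 1F))
opening-B-wins zero 2F = from-just (searchWin 14 (afterOpeningᴮ 0 2F))
opening-B-wins (suc k) 0F = play _ (leaveᴮᴬ 1F refl) (every reply)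
  where
  c : Count
  c = State.counts (afterOpeningᴮ (suc k) 0F)
  reply : ∀ s′ → Step (st (release (delete (delete fresh 0F) 1F) c) (AA 0F 1F)) s′ → Wins s′
  reply _ (enterᴬᴬ m h n eq) with entry m 0F h
  reply _ (enterᴬᴬ _ h n eq) | via-path path₀₁ = ⊥-elim (0≢1+n eq)
  reply _ (enterᴬᴬ _ h n eq) | via-path path₀₂ = ⊥-elim (0≢1+n eq)
  reply _ (enterᴬᴬ _ () n eq) | via-path path₁₂
  reply _ (enterᴬᴬ _ h n eq) | via-deadEnd = ⊥-elim (0≢1+n eq)
  reply _ (enterᴬᴬ _ h n eq) | via-fresh = play _ (enterᴬᴮ (delete fresh 0F) refl 0 refl) (every λ
    { _ (leaveᴮᴮ 0F ())
    ; _ (leaveᴮᴮ 1F _) → play _ (leaveᴮᴬ 2F refl) (rounds-left-lose k 1F 2F refl (pathFree refl refl refl))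
    ; _ (leaveᴮᴮ 2F _) → play _ (leaveᴮᴬ 2F refl) (rounds-left-lose k 2F 2F refl (pathFree refl refl refl)) })
opening-B-wins (suc k) 1F = play _ (leaveᴮᴬ 2F refl) (every reply)
  where
  c : Count
  c = State.counts (afterOpeningᴮ (suc k) 1F)
  reply : ∀ s′ → Step (st (release (delete (delete fresh 0F) 2F) c) (AA 1F 2F)) s′ → Wins s′
  reply _ (enterᴬᴬ m h n eq) with entry m 1F h
  reply _ (enterᴬᴬ _ h n eq) | via-path path₀₁ = ⊥-elim (0≢1+n eq)
  reply _ (enterᴬᴬ _ () n eq) | via-path path₀₂
  reply _ (enterᴬᴬ _ h n eq) | via-path path₁₂ = ⊥-elim (0≢1+n eq)
  reply _ (enterᴬᴬ _ h n eq) | via-deadEnd = play _ (enterᴬᴮ fresh refl _ refl) (stuckᴮᴮ refl)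
  reply _ (enterᴬᴬ _ h n eq) | via-fresh = play _ (enterᴬᴮ (delete fresh 1F) refl 0 refl) (every λ
    { _ (leaveᴮᴮ 1F ())
    ; _ (leaveᴮᴮ 0F _) → play _ (leaveᴮᴬ 0F refl) (rounds-left-lose k 0F 0F refl (pathFree refl refl refl))
    ; _ (leaveᴮᴮ 2F _) → play _ (leaveᴮᴬ 0F refl) (rounds-left-lose k 2F 0F refl (pathFree refl refl refl)) })
opening-B-wins (suc k) 2F = play _ (leaveᴮᴬ 1F refl) (every reply)
  where
  c : Count
  c = State.counts (afterOpeningᴮ (suc k) 2F)
  reply : ∀ s′ → Step (st (release (delete (delete fresh 0F) 1F) c) (AA 2F 1F)) s′ → Wins s′
  reply _ (enterᴬᴬ m h n eq) with entry m 2F h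
  reply _ (enterᴬᴬ _ () n eq) | via-path path₀₁
  reply _ (enterᴬᴬ _ h n eq) | via-path path₀₂ = ⊥-elim (0≢1+n eq)
  reply _ (enterᴬᴬ _ h n eq) | via-path path₁₂ = ⊥-elim (0≢1+n eq)
  reply _ (enterᴬᴬ _ h n eq) | via-deadEnd = play _ (enterᴬᴮ fresh refl _ refl) (stuckᴮᴮ refl)
  reply _ (enterᴬᴬ _ h n eq) | via-fresh = play _ (enterᴬᴮ (delete fresh 2F) refl 0 refl) (every λ
    { _ (leaveᴮᴮ 2F ())
    ; _ (leaveᴮᴮ 0F _) → play _ (leaveᴮᴬ 0F refl) (rounds-left-lose k 0F 0F refl (pathFree refl refl refl))
    ; _ (leaveᴮᴮ 1F _) → play _ (leaveᴮᴬ 0F refl) (rounds-left-lose k 1F 0F refl (pathFree refl refl refl)) })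

opening-B-loses : ∀ k → Loses (st (occupy fresh (freshOnly (4 + (k + k)))) (BB fresh (delete fresh 0F)))
opening-B-loses k = every λ { _ (leaveᴮᴮ a _) → opening-B-wins k a }

module FirstMove (k : ℕ) where
  q : ℕ
  q = 5 + (k + k)
  open Abstraction q
  open Bipartite 3 q
  open TrailTrap (K 3 q) hiding (P1-win; P2-win)
  open Mirror (K 3 q) using (Used-∷⁻)

  initial-AA : ∀ a → Tallies [] (A 0F) (A a) (freshOnly q)
  initial-AA a = tallied λ m → trans (count-cong λ j → cong (_∧ (fresh ==ᴹ m)) (vacant-AA 0F a j))
                                     (count-const (fresh ==ᴹ m))

  initial-AB : ∀ j → Tallies [] (A 0F) (B j) (freshOnly (pred q))
  initial-AB j = tallied λ m →
    one-fewer (fresh ==ᴹ m) (trans (count-change (λ _ → fresh ==ᴹ m) (P m) j (agree m))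
                                   (cong (λ b → count {q} (λ _ → fresh ==ᴹ m) + indicator b) (at-j m)))
    where
    P : Mask → Fin q → Bool
    P m j′ = vacant (A 0F) (B j) j′ ∧ (fresh ==ᴹ m)
    agree : ∀ m j′ → j′ ≢ j → fresh ==ᴹ m ≡ P m j′
    agree m j′ j′≢j = sym (cong (_∧ (fresh ==ᴹ m)) (vacant-AB 0F (≢-sym j′≢j)))
    at-j : ∀ m → P m j ≡ false
    at-j m = cong₂ (λ u v → (u ∧ v) ∧ (fresh ==ᴹ m)) (notAt-A 0F j) (notAt-self j)
    one-fewer : ∀ {x} b → x + indicator b ≡ count {q} (λ _ → b) + 0 → x ≡ (if b then pred q else 0)
    one-fewer true  eq = drop-indicator true  (trans eq (trans (+-identityʳ _) (count-const {q} true)))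
    one-fewer false eq = drop-indicator false (trans eq (trans (+-identityʳ _) (count-const {q} false)))

  U₁ : List (V × V)
  U₁ = (A 0F , B 0F) ∷ []

  start-mask : mask U₁ 0F ≡ delete fresh 0F
  start-mask = mask-inserted {[]} {0F} {0F} (inj₁ refl)

  reply-position : ∀ u → ∃ λ s → Abstracts U₁ u (B 0F) s × Loses s
  reply-position u with side u
  ... | left a =
    st (occupy fresh (freshOnly q)) (AB a (delete fresh 0F)) ,
    ((refl , 0F , refl , start-mask) , tallies-enter {[]} {0F} {0F} (notAt-A a 0F) (initial-AA a)) ,
    opening-A-loses k a
  ... | right j with j ≟ 0F
  ...   | yes refl =
    st (freshOnly (pred q)) (shared (delete fresh 0F)) ,
    ((0F , refl , refl , start-mask) , tallies-join {[]} {0F} {0F} (initial-AB 0F)) ,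
    opening-shared-loses k
  ...   | no j≢0 =
    st (occupy fresh (freshOnly (pred q))) (BB fresh (delete fresh 0F)) ,
    ((j , 0F , refl , refl , j≢0 , mask-elsewhere {[]} {0F} {0F} (inj₁ refl) j≢0 , start-mask) ,
     tallies-enter {[]} {0F} {0F} (notAt-other j≢0) (initial-AB j)) ,
    opening-B-loses k

  unused-after-first : ∀ {u x} → ¬ SameEdge u x (A 0F) (B 0F) → ¬ Used U₁ u x
  unused-after-first other used with Used-∷⁻ used
  ... | inj₁ same = other same
  ... | inj₂ (inj₁ ())
  ... | inj₂ (inj₂ ())

  p1-wins : P1-win (K 3 q)
  p1-wins = A 0F , B 0F , left-right-adj 0F 0F , λ u x ux other →
    let (s , abstracts , loses) = reply-position u
        (s′ , step , abstracts′) = abstract-step s abstracts ux (unused-after-first other)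
    in Wins⇒Win s′ abstracts′ (loses-reply loses step)

odd-form : ∀ q → ¬ 2 ∣ q → ∃ λ k → q ≡ suc (k + k)
odd-form zero          odd = ⊥-elim (odd (divides 0 refl))
odd-form (suc zero)    _   = 0 , refl
odd-form (suc (suc q)) odd with odd-form q (odd ∘ ∣m∣n⇒∣m+n ∣-refl)
... | k , refl = suc k , cong (2 +_) (sym (+-suc k k))

odd-≥5-form : ∀ q → 5 ≤ q → ¬ 2 ∣ q → ∃ λ k → q ≡ 5 + (k + k)
odd-≥5-form q 5≤q odd with odd-form q odd
... | zero , refl with s≤s () ← 5≤q
... | suc zero , refl with s≤s (s≤s (s≤s ())) ← 5≤q
... | suc (suc k) , refl = k , cong (3 +_) (trans (+-suc k (suc k)) (cong (1 +_) (+-suc k k)))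

theorem3p2 : (p q : ℕ) → 1 ≤ p → 1 ≤ q →
    (((2 ∣ p) ⊎ (2 ∣ q) → P2-win (K p q)) ×
     (p ≡ 3 → 5 ≤ q → ¬ (2 ∣ q) → P1-win (K p q)))
theorem3p2 p q _ _ = even-side⇒P2-win p q , odd-side
  where
  odd-side : p ≡ 3 → 5 ≤ q → ¬ (2 ∣ q) → P1-win (K p q)
  odd-side refl 5≤q odd with odd-≥5-form q 5≤q odd
  ... | k , refl = FirstMove.p1-wins k
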